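{- For any positive integers $k$ and $b$ with $b\ge \frac{k}{2}$, there exists a graph $G^k_b$ such that $b_t^k(G^k_b)=b$.
   Context: All graphs are finite, simple, undirected, without isolated vertices. A total dominating set of a graph without isolated vertices is a vertex set $S$ such that every vertex is adjacent to some vertex of $S$; $\gamma_t(G)$ is the minimum size of such a set. The $k$-total bondage number $b_t^k(G)$ is the minimum number of edges that must be deleted from $G$ so that the resulting graph (required to have no isolated vertices) has total domination number at least $\gamma_t(G)+k$. -}

module Defs where

open import Data.Nat using (ℕ; _+_; _∸_; _≤_; _<ᵇ_)
open import Data.Bool using (Bool; true; false; T; _∧_; if_then_else_)
open import Data.Fin using (Fin; toℕ)
open import Data.Fin.Subset using (Subset; _∈_; ∣_∣)
open import Data.List using (List; map; allFin)
open import Data.Nat.ListAction using (sum)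
open import Data.Product using (Σ; ∃; ∃-syntax; _×_; _,_)
open import Relation.Binary.PropositionalEquality using (_≡_)

record Graph (n : ℕ) : Set where
  field
    adj    : Fin n → Fin n → Bool
    sym    : ∀ u v → adj u v ≡ adj v u
    irrefl : ∀ v → adj v v ≡ false
open Graph public

Adj : ∀ {n} → Graph n → Fin n → Fin n → Set
Adj G u v = T (adj G u v)

NoIsolated : ∀ {n} → Graph n → Set
NoIsolated {n} G = ∀ (v : Fin n) → ∃[ u ] Adj G v u

edgeCount : ∀ {n} → Graph n → ℕ
edgeCount {n} G =
  sum (map (λ u → sum (map (λ v → if (toℕ u <ᵇ toℕ v) ∧ adj G u v then 1 else 0)
                           (allFin n)))
           (allFin n))

IsTDS : ∀ {n} → Graph n → Subset n → Set
IsTDS {n} G S = ∀ (v : Fin n) → ∃[ u ] (u ∈ S × Adj G v u)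

IsGammaT : ∀ {n} → Graph n → ℕ → Set
IsGammaT {n} G m =
  (∃[ S ] (IsTDS G S × ∣ S ∣ ≡ m)) × (∀ (S : Subset n) → IsTDS G S → m ≤ ∣ S ∣)

SpanningSub : ∀ {n} → Graph n → Graph n → Set
SpanningSub {n} H G = ∀ (u v : Fin n) → Adj H u v → Adj G u v

KDeletion : ∀ {n} → ℕ → Graph n → Graph n → ℕ → Set
KDeletion k G H d =
  SpanningSub H G × NoIsolated H × (edgeCount G ∸ edgeCount H ≡ d) ×
  (∃[ g ] ∃[ g' ] (IsGammaT G g × IsGammaT H g' × g + k ≤ g'))

IsKTotalBondage : ∀ {n} → ℕ → Graph n → ℕ → Set
IsKTotalBondage {n} k G b =
  (∃[ H ] KDeletion k G H b) ×
  (∀ (H : Graph n) (d : ℕ) → KDeletion k G H d → b ≤ d)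

-- G^k_b has m = k + b + 1 supports, each carrying a pendant leaf. The supports k, …, m − 1 form a
-- clique K_{b+1}, and b further "link" edges attach every one of the k private supports 0, …, k − 1
-- to another support (b links can touch k vertices because k ≤ 2b). A leaf forces its support into
-- every total dominating set, and the supports dominate G, so γt(G) = m. Deleting the b links leaves
-- each private support adjacent only to its leaf, which forces the k private leaves as well:
-- γt = m + k. Conversely, let a deletion raise γt to at least m + k. If no private support keeps a
-- neighbour among the supports, all b links are gone. If some clique vertex keeps none, all of its
-- b clique edges are gone. Otherwise, with c a private support that keeps one, the supports together
-- with the private leaves other than that of c still dominate, a set of size m + k − 1.

module Submission where

open import Defs hiding (sym)
open import Data.Nat
  using (ℕ; zero; suc; _+_; _*_; _∸_; _⊓_; _≤_; _<_; _<ᵇ_; _≤ᵇ_; _≡ᵇ_; pred; z≤n; s≤s; z<s; >-nonZero)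
open import Data.Nat.Properties
open import Algebra.Properties.CommutativeMonoid.Sum +-0-commutativeMonoid
  using (sum; sum-syntax; sum-cong-≗; sum-replicate-zero; ∑-distrib-+; ∑-comm)
open import Data.Bool using (Bool; true; false; T; _∧_; _∨_; not; if_then_else_)
open import Data.Bool.Properties using (T-∧; T-∨; T-≡; ∨-comm)
open import Data.Empty using (⊥-elim)
import Data.Fin as Fin
open import Data.Fin using (Fin; zero; suc; toℕ; fromℕ<; _↑ˡ_; _↑ʳ_; splitAt)
open import Data.Fin.Properties
  using (toℕ-injective; toℕ<n; toℕ-fromℕ<; toℕ-↑ˡ; toℕ-↑ʳ; ↑ʳ-injective; splitAt⁻¹-↑ˡ; splitAt⁻¹-↑ʳ; any?)
open import Data.Fin.Subset using (Subset; _⊆_; _∈_; ∣_∣; _-_)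
open import Data.Fin.Subset.Properties using (p⊆q⇒∣p∣≤∣q∣; x∈p∧x≢y⇒x∈p-y; x∈p⇒∣p-x∣<∣p∣)
import Data.List as List using (map; tabulate; allFin)
open import Data.List.Properties using (map-tabulate)
import Data.Nat.ListAction as List using (sum)
open import Data.Product using (Σ; ∃-syntax; _×_; _,_; proj₁; proj₂)
open import Data.Sum as Sum using (_⊎_; inj₁; inj₂)
open import Data.Unit using (tt)
open import Data.Vec using (tabulate)
open import Data.Vec.Properties using (lookup∘tabulate; []=⇒lookup; lookup⇒[]=)
open import Function using (_∘_; id)
open import Function.Bundles using (Equivalence; _⇔_)
open import Relation.Nullary using (¬_; Dec; yes; no)
open import Relation.Nullary.Decidable using (_×-dec_; ¬?; T?)
open import Relation.Binary.PropositionalEquality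

open Equivalence using (to; from)

𝟙 : Bool → ℕ
𝟙 b = if b then 1 else 0

𝟙-mono : ∀ {x y} → (T x → T y) → 𝟙 x ≤ 𝟙 y
𝟙-mono {false}         _ = z≤n
𝟙-mono {true} {true}   _ = ≤-refl
𝟙-mono {true} {false}  f = ⊥-elim (f tt)

𝟙-cong : ∀ {x y} → (T x → T y) → (T y → T x) → 𝟙 x ≡ 𝟙 y
𝟙-cong f g = ≤-antisym (𝟙-mono f) (𝟙-mono g)

𝟙-∨ : ∀ x y → ¬ (T x × T y) → 𝟙 (x ∨ y) ≡ 𝟙 x + 𝟙 y
𝟙-∨ false y     _ = refl
𝟙-∨ true  false _ = refl
𝟙-∨ true  true  f = ⊥-elim (f (tt , tt))

𝟙-split : ∀ a g h → (T h → T g) → 𝟙 (a ∧ g) ≡ 𝟙 (a ∧ h) + 𝟙 (a ∧ (g ∧ not h))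
𝟙-split false g     h     _   = refl
𝟙-split true  false true  h⇒g = ⊥-elim (h⇒g tt)
𝟙-split true  true  true  _   = refl
𝟙-split true  false false _   = refl
𝟙-split true  true  false _   = refl

T-not⁺ : ∀ {x} → ¬ T x → T (not x)
T-not⁺ {false} _ = tt
T-not⁺ {true}  f = f tt

T-not⁻ : ∀ {x} → T (not x) → ¬ T x
T-not⁻ {false} _ ()

sum-mono : ∀ {n} (f g : Fin n → ℕ) → (∀ i → f i ≤ g i) → sum f ≤ sum g
sum-mono {zero}  f g _   = z≤n
sum-mono {suc n} f g f≤g = +-mono-≤ (f≤g zero) (sum-mono (f ∘ suc) (g ∘ suc) (f≤g ∘ suc))

sum-tabulate : ∀ {n} (f : Fin n → ℕ) → List.sum (List.tabulate f) ≡ sum f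
sum-tabulate {zero}  f = refl
sum-tabulate {suc n} f = cong (f zero +_) (sum-tabulate (f ∘ suc))

sum-allFin : ∀ {n} (f : Fin n → ℕ) → List.sum (List.map f (List.allFin n)) ≡ sum f
sum-allFin f = trans (cong List.sum (map-tabulate id f)) (sum-tabulate f)

<ᵇ-suc : ∀ a j → (a <ᵇ suc j) ≡ (a ≤ᵇ j)
<ᵇ-suc zero    j = refl
<ᵇ-suc (suc a) j = refl

count-between : ∀ n a c → a ≤ c → c ≤ n →
                ∑[ i < n ] 𝟙 ((a ≤ᵇ toℕ i) ∧ (toℕ i <ᵇ c)) ≡ c ∸ a
count-between n       zero    zero    _         _         = sum-replicate-zero n
count-between zero    zero    (suc c) _         ()
count-between (suc n) zero    (suc c) _         (s≤s c≤n) = cong suc (count-between n zero c z≤n c≤n)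
count-between (suc n) (suc a) (suc c) (s≤s a≤c) (s≤s c≤n) =
  trans (sum-cong-≗ {n} (λ i → cong (λ x → 𝟙 (x ∧ (toℕ i <ᵇ c))) (<ᵇ-suc a (toℕ i))))
        (count-between n a c a≤c c≤n)

count-≡ : ∀ n c x → c < n → ∑[ i < n ] 𝟙 ((toℕ i ≡ᵇ c) ∧ x) ≡ 𝟙 x
count-≡ (suc n) zero    x _         = trans (cong (𝟙 x +_) (sum-replicate-zero n)) (+-identityʳ (𝟙 x))
count-≡ (suc n) (suc c) x (s≤s c<n) = count-≡ n c x c<n

∸-telescope : ∀ {a p c} → a ≤ p → p ≤ a + c → (a + c ∸ p) + (p ∸ a) ≡ c
∸-telescope {a} {p} {c} a≤p p≤a+c = begin
    (a + c ∸ p) + t        ≡⟨ cong (λ x → (a + c ∸ x) + t) (sym a+t≡p) ⟩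
    (a + c ∸ (a + t)) + t  ≡⟨ cong (_+ t) ([m+n]∸[m+o]≡n∸o a c t) ⟩
    (c ∸ t) + t            ≡⟨ m∸n+n≡m (+-cancelˡ-≤ a t c (subst (_≤ a + c) (sym a+t≡p) p≤a+c)) ⟩
    c                      ∎
  where
  open ≡-Reasoning
  t = p ∸ a
  a+t≡p : a + t ≡ p
  a+t≡p = m+[n∸m]≡n a≤p

below : ∀ {n} → ℕ → Subset n
below a = tabulate (λ i → toℕ i <ᵇ a)

∣below∣ : ∀ n a → a ≤ n → ∣ below {n} a ∣ ≡ a
∣below∣ zero    zero    _       = refl
∣below∣ (suc n) zero    _       = ∣below∣ n zero z≤n
∣below∣ (suc n) (suc a) (s≤s p) = cong suc (∣below∣ n a p)

∈below : ∀ {n a} {i : Fin n} → toℕ i < a → i ∈ below a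
∈below {i = i} i<a = lookup⇒[]= i _ (trans (lookup∘tabulate _ i) (to T-≡ (<⇒<ᵇ i<a)))

∈below⁻ : ∀ {n a} {i : Fin n} → i ∈ below a → toℕ i < a
∈below⁻ {a = a} {i} i∈ =
  <ᵇ⇒< (toℕ i) a (from T-≡ (trans (sym (lookup∘tabulate _ i)) ([]=⇒lookup i∈)))

Adj-sym : ∀ {n} (G : Graph n) u v → Adj G u v → Adj G v u
Adj-sym G u v = subst T (Graph.sym G u v)

fromRelation : ∀ n (R : ℕ → ℕ → Bool) → (∀ {i j} → T (R i j) → i < j) → Graph n
fromRelation n R R⇒< = record
  { adj    = λ u v → R (toℕ u) (toℕ v) ∨ R (toℕ v) (toℕ u)
  ; sym    = λ u v → ∨-comm (R (toℕ u) (toℕ v)) (R (toℕ v) (toℕ u))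
  ; irrefl = loopless
  }
  where
  loopless : ∀ v → R (toℕ v) (toℕ v) ∨ R (toℕ v) (toℕ v) ≡ false
  loopless v with R (toℕ v) (toℕ v) in eq
  ... | false = refl
  ... | true  = ⊥-elim (<-irrefl refl (R⇒< (subst T (sym eq) tt)))

module _ {n : ℕ} where

  Removed : Graph n → Graph n → Fin n → Fin n → Set
  Removed G H u v = toℕ u < toℕ v × Adj G u v × ¬ Adj H u v

  removed : Graph n → Graph n → Fin n → Fin n → Bool
  removed G H u v = (toℕ u <ᵇ toℕ v) ∧ (adj G u v ∧ not (adj H u v))

  Removed⇒removed : ∀ {G H u v} → Removed G H u v → T (removed G H u v)
  Removed⇒removed (u<v , uv∈G , uv∉H) = from T-∧ (<⇒<ᵇ u<v , from T-∧ (uv∈G , T-not⁺ uv∉H))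

  removed⇒Removed : ∀ {G H} u v → T (removed G H u v) → Removed G H u v
  removed⇒Removed u v t with to T-∧ t
  ... | u<v , t′ with to T-∧ t′
  ...   | uv∈G , uv∉H = <ᵇ⇒< (toℕ u) (toℕ v) u<v , uv∈G , T-not⁻ uv∉H

  edgeCount≡∑ : ∀ G → edgeCount G ≡ ∑[ u < n ] ∑[ v < n ] 𝟙 ((toℕ u <ᵇ toℕ v) ∧ adj G u v)
  edgeCount≡∑ G = trans (sum-allFin {n} _) (sum-cong-≗ {n} (λ u → sum-allFin {n} _))

  edgeCount-∸ : ∀ G H → SpanningSub H G →
                edgeCount G ∸ edgeCount H ≡ ∑[ u < n ] ∑[ v < n ] 𝟙 (removed G H u v)
  edgeCount-∸ G H H⊆G = begin
      edgeCount G ∸ edgeCount H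
    ≡⟨ cong (_∸ edgeCount H) (edgeCount≡∑ G) ⟩
      ∑[ u < n ] ∑[ v < n ] 𝟙 (kept G u v) ∸ edgeCount H
    ≡⟨ cong (_∸ edgeCount H) (sum-cong-≗ {n} λ u → sum-cong-≗ {n} λ v →
         𝟙-split (toℕ u <ᵇ toℕ v) (adj G u v) (adj H u v) (H⊆G u v)) ⟩
      ∑[ u < n ] ∑[ v < n ] (𝟙 (kept H u v) + 𝟙 (removed G H u v)) ∸ edgeCount H
    ≡⟨ cong (_∸ edgeCount H) (sum-cong-≗ {n} λ u → ∑-distrib-+ (λ v → 𝟙 (kept H u v)) _) ⟩
      ∑[ u < n ] (∑[ v < n ] 𝟙 (kept H u v) + ∑[ v < n ] 𝟙 (removed G H u v)) ∸ edgeCount H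
    ≡⟨ cong (_∸ edgeCount H) (∑-distrib-+ (λ u → ∑[ v < n ] 𝟙 (kept H u v)) _) ⟩
      ∑[ u < n ] ∑[ v < n ] 𝟙 (kept H u v) + ∑[ u < n ] ∑[ v < n ] 𝟙 (removed G H u v) ∸ edgeCount H
    ≡⟨ cong (λ e → e + ∑[ u < n ] ∑[ v < n ] 𝟙 (removed G H u v) ∸ edgeCount H)
            (sym (edgeCount≡∑ H)) ⟩
      edgeCount H + ∑[ u < n ] ∑[ v < n ] 𝟙 (removed G H u v) ∸ edgeCount H
    ≡⟨ m+n∸m≡n (edgeCount H) _ ⟩
      ∑[ u < n ] ∑[ v < n ] 𝟙 (removed G H u v)
    ∎
    where
    open ≡-Reasoning
    kept : Graph n → Fin n → Fin n → Bool
    kept X u v = (toℕ u <ᵇ toℕ v) ∧ adj X u v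

  removedCount-≥ : ∀ G H → SpanningSub H G → (R : Fin n → Fin n → Bool) →
                   (∀ u v → T (R u v) → Removed G H u v) →
                   ∑[ u < n ] ∑[ v < n ] 𝟙 (R u v) ≤ edgeCount G ∸ edgeCount H
  removedCount-≥ G H H⊆G R R⇒Removed =
    subst (_ ≤_) (sym (edgeCount-∸ G H H⊆G))
      (sum-mono _ _ λ u → sum-mono _ _ λ v → 𝟙-mono (Removed⇒removed {G} {H} ∘ R⇒Removed u v))

  removedCount-≡ : ∀ G H → SpanningSub H G → (R : Fin n → Fin n → Bool) →
                   (∀ u v → T (R u v) → Removed G H u v) → (∀ u v → Removed G H u v → T (R u v)) →
                   ∑[ u < n ] ∑[ v < n ] 𝟙 (R u v) ≡ edgeCount G ∸ edgeCount H
  removedCount-≡ G H H⊆G R R⇒Removed Removed⇒R =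
    trans (sum-cong-≗ {n} λ u → sum-cong-≗ {n} λ v →
             𝟙-cong (Removed⇒removed {G} {H} ∘ R⇒Removed u v)
                    (Removed⇒R u v ∘ removed⇒Removed {G} {H} u v))
          (sym (edgeCount-∸ G H H⊆G))

  sole-neighbour-∈ : ∀ (G H : Graph n) S w {u} → SpanningSub H G → (∀ x → Adj G w x → x ≡ u) →
                     IsTDS H S → u ∈ S
  sole-neighbour-∈ G H S w H⊆G sole S-dominates with S-dominates w
  ... | x , x∈S , wx∈H = subst (_∈ S) (sole x (H⊆G w x wx∈H)) x∈S

  sole-neighbour-kept : ∀ (G H : Graph n) w {u} → SpanningSub H G → (∀ x → Adj G w x → x ≡ u) →
                        NoIsolated H → Adj H w u
  sole-neighbour-kept G H w H⊆G sole no-isolated with no-isolated w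
  ... | x , wx∈H = subst (Adj H w) (sole x (H⊆G w x wx∈H)) wx∈H

  NoIsolated-mono : ∀ (G H : Graph n) → SpanningSub H G → NoIsolated H → NoIsolated G
  NoIsolated-mono G H H⊆G no-isolated v with no-isolated v
  ... | u , vu∈H = u , H⊆G v u vu∈H

  ⊆-every-TDS⇒IsGammaT : ∀ (G : Graph n) S → IsTDS G S → (∀ S′ → IsTDS G S′ → S ⊆ S′) →
                         IsGammaT G ∣ S ∣
  ⊆-every-TDS⇒IsGammaT G S S-dominates S-minimum =
    (S , S-dominates , refl) , λ S′ S′-dominates → p⊆q⇒∣p∣≤∣q∣ (S-minimum S′ S′-dominates)

module Construction (k b : ℕ) (1≤k : 1 ≤ k) (1≤b : 1 ≤ b) (k≤2b : k ≤ 2 * b) where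

  s m n : ℕ
  s = k ⊓ b
  m = suc (k + b)
  n = m + m

  1≤s : 1 ≤ s
  1≤s = ⊓-glb 1≤k 1≤b

  k≤b+s : k ≤ b + s
  k≤b+s = subst (k ≤_) (sym (+-distribˡ-⊓ b k b))
            (⊓-glb (m≤n+m k b) (subst (λ x → k ≤ b + x) (+-identityʳ b) k≤2b))

  b+s<m : b + s < m
  b+s<m = s≤s (subst (b + s ≤_) (+-comm b k) (+-monoʳ-≤ b (m⊓n≤m k b)))

  k<m : k < m
  k<m = s≤s (m≤m+n k b)

  m≤n : m ≤ n
  m≤n = m≤m+n m m

  -- Vertex i < m is a support and m + i its leaf. Link j (for s ≤ j < b + s) joins j to the private
  -- support partner j; as j runs through this range, either j or partner j meets every private support.
  partner : ℕ → ℕ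
  partner j = (j ∸ s) ⊓ pred k

  pendant clique link base edge : ℕ → ℕ → Bool
  pendant i j = (i <ᵇ m) ∧ (j ≡ᵇ m + i)
  clique  i j = (k ≤ᵇ i) ∧ ((i <ᵇ j) ∧ (j <ᵇ m))
  link    i j = (i ≡ᵇ partner j) ∧ ((s ≤ᵇ j) ∧ (j <ᵇ b + s))
  base    i j = pendant i j ∨ clique i j
  edge    i j = base i j ∨ link i j

  pendant⁻ : ∀ {i j} → T (pendant i j) → i < m × j ≡ m + i
  pendant⁻ {i} {j} t with to T-∧ t
  ... | i<m , j≡m+i = <ᵇ⇒< i m i<m , ≡ᵇ⇒≡ j (m + i) j≡m+i

  clique⁻ : ∀ {i j} → T (clique i j) → k ≤ i × i < j × j < m
  clique⁻ {i} {j} t with to T-∧ t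
  ... | k≤i , t′ with to T-∧ t′
  ...   | i<j , j<m = ≤ᵇ⇒≤ k i k≤i , <ᵇ⇒< i j i<j , <ᵇ⇒< j m j<m

  partner<k : ∀ j → partner j < k
  partner<k j = m≤pred[n]⇒suc[m]≤n {{>-nonZero 1≤k}} (m⊓n≤n (j ∸ s) (pred k))

  partner<self : ∀ {j} → s ≤ j → partner j < j
  partner<self {j} s≤j = ≤-<-trans (m⊓n≤m (j ∸ s) (pred k)) (∸-monoʳ-< {j} {s} {0} 1≤s s≤j)

  link⁻ : ∀ {i j} → T (link i j) → i < k × i < j × j < m
  link⁻ {i} {j} t with to T-∧ t
  ... | i≡partner , t′ with to T-∧ t′
  ...   | s≤j , j<b+s =
    subst (_< k) (sym i≡) (partner<k j) ,
    subst (_< j) (sym i≡) (partner<self (≤ᵇ⇒≤ s j s≤j)) ,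
    <-trans (<ᵇ⇒< j (b + s) j<b+s) b+s<m
    where i≡ = ≡ᵇ⇒≡ i (partner j) i≡partner

  link⁺ : ∀ {j} → s ≤ j → j < b + s → T (link (partner j) j)
  link⁺ {j} s≤j j<b+s =
    from T-∧ (≡⇒≡ᵇ (partner j) (partner j) refl , from T-∧ (≤⇒≤ᵇ s≤j , <⇒<ᵇ j<b+s))

  edge⁻ : ∀ {i j} → T (edge i j) → (i < m × j ≡ m + i) ⊎ (i < j × j < m)
  edge⁻ {i} {j} t with to (T-∨ {base i j}) t
  ... | inj₂ l = let (_ , i<j , j<m) = link⁻ l in inj₂ (i<j , j<m)
  ... | inj₁ e with to (T-∨ {pendant i j}) e
  ...   | inj₁ p = inj₁ (pendant⁻ p)
  ...   | inj₂ c = let (_ , i<j , j<m) = clique⁻ c in inj₂ (i<j , j<m)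

  edge⇒< : ∀ {i j} → T (edge i j) → i < j
  edge⇒< {i} {j} t with edge⁻ t
  ... | inj₁ (_ , j≡m+i)  = subst (i <_) (sym j≡m+i) (m<n+m i z<s)
  ... | inj₂ (i<j , _)    = i<j

  edge⇒support : ∀ {i j} → T (edge i j) → i < m
  edge⇒support t with edge⁻ t
  ... | inj₁ (i<m , _)    = i<m
  ... | inj₂ (i<j , j<m)  = <-trans i<j j<m

  edge-into-leaf : ∀ {i j} → T (edge i j) → m ≤ j → j ≡ m + i
  edge-into-leaf t m≤j with edge⁻ t
  ... | inj₁ (_ , j≡m+i)  = j≡m+i
  ... | inj₂ (_ , j<m)    = ⊥-elim (<⇒≱ j<m m≤j)

  base⇒edge : ∀ {i j} → T (base i j) → T (edge i j)
  base⇒edge {i} {j} t = from (T-∨ {base i j}) (inj₁ t)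

  G H₀ : Graph n
  G  = fromRelation n edge edge⇒<
  H₀ = fromRelation n base (edge⇒< ∘ base⇒edge)

  Adj-G : ∀ u v → Adj G u v ⇔ (T (edge (toℕ u) (toℕ v)) ⊎ T (edge (toℕ v) (toℕ u)))
  Adj-G u v = T-∨ {edge (toℕ u) (toℕ v)}

  Adj-H₀ : ∀ u v → Adj H₀ u v ⇔ (T (base (toℕ u) (toℕ v)) ⊎ T (base (toℕ v) (toℕ u)))
  Adj-H₀ u v = T-∨ {base (toℕ u) (toℕ v)}

  H₀⊆G : SpanningSub H₀ G
  H₀⊆G u v = from (Adj-G u v) ∘ Sum.map base⇒edge base⇒edge ∘ to (Adj-H₀ u v)

  support leaf : Fin m → Fin n
  support i = i ↑ˡ m
  leaf    i = m ↑ʳ i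

  data Vertex : Fin n → Set where
    at-support : ∀ i → Vertex (support i)
    at-leaf    : ∀ i → Vertex (leaf i)

  vertex : ∀ v → Vertex v
  vertex v with splitAt m v in eq
  ... | inj₁ i = subst Vertex (splitAt⁻¹-↑ˡ eq) (at-support i)
  ... | inj₂ i = subst Vertex (splitAt⁻¹-↑ʳ eq) (at-leaf i)

  toℕ-support : ∀ i → toℕ (support i) ≡ toℕ i
  toℕ-support i = toℕ-↑ˡ i m

  toℕ-leaf : ∀ i → toℕ (leaf i) ≡ m + toℕ i
  toℕ-leaf i = toℕ-↑ʳ m i

  support<m : ∀ i → toℕ (support i) < m
  support<m i = subst (_< m) (sym (toℕ-support i)) (toℕ<n i)

  m≤leaf : ∀ i → m ≤ toℕ (leaf i)
  m≤leaf i = subst (m ≤_) (sym (toℕ-leaf i)) (m≤m+n m (toℕ i))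

  pendant⁺ : ∀ {i} → i < m → T (pendant i (m + i))
  pendant⁺ {i} i<m = from T-∧ (<⇒<ᵇ i<m , ≡⇒≡ᵇ (m + i) (m + i) refl)

  clique⁺ : ∀ {i j} → k ≤ i → i < j → j < m → T (clique i j)
  clique⁺ {i} {j} k≤i i<j j<m =
    from T-∧ (≤⇒≤ᵇ k≤i , from (T-∧ {i <ᵇ j}) (<⇒<ᵇ i<j , <⇒<ᵇ j<m))

  pendant⇒base : ∀ {i j} → T (pendant i j) → T (base i j)
  pendant⇒base {i} {j} t = from (T-∨ {pendant i j}) (inj₁ t)

  base⁻ : ∀ {i j} → T (base i j) → T (pendant i j) ⊎ T (clique i j)
  base⁻ {i} {j} = to (T-∨ {pendant i j})

  clique⇒base : ∀ {i j} → T (clique i j) → T (base i j)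
  clique⇒base {i} {j} t = from (T-∨ {pendant i j}) (inj₂ t)

  link⇒edge : ∀ {i j} → T (link i j) → T (edge i j)
  link⇒edge {i} {j} t = from (T-∨ {base i j}) (inj₂ t)

  base-at-private : ∀ {i j} → i < k → T (base i j) ⊎ T (base j i) → j ≡ m + i
  base-at-private {i} {j} i<k (inj₁ t) with base⁻ {i} {j} t
  ... | inj₁ p = proj₂ (pendant⁻ {i} {j} p)
  ... | inj₂ c = ⊥-elim (<⇒≱ i<k (proj₁ (clique⁻ {i} {j} c)))
  base-at-private {i} {j} i<k (inj₂ t) with base⁻ {j} {i} t
  ... | inj₁ p =
    ⊥-elim (<⇒≱ (<-trans i<k k<m) (subst (m ≤_) (sym (proj₂ (pendant⁻ {j} {i} p))) (m≤m+n m j)))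
  ... | inj₂ c =
    let (k≤j , j<i , _) = clique⁻ {j} {i} c in ⊥-elim (<⇒≱ i<k (≤-trans k≤j (<⇒≤ j<i)))

  support-leaf : ∀ i → Adj H₀ (support i) (leaf i)
  support-leaf i =
    from (Adj-H₀ (support i) (leaf i)) (inj₁ (pendant⇒base {toℕ (support i)} {toℕ (leaf i)}
    (subst₂ (λ x y → T (pendant x y)) (sym (toℕ-support i)) (sym (toℕ-leaf i)) (pendant⁺ (toℕ<n i)))))

  leaf-support : ∀ i → Adj H₀ (leaf i) (support i)
  leaf-support i = Adj-sym H₀ (support i) (leaf i) (support-leaf i)

  clique-adj : ∀ i j → T (clique (toℕ i) (toℕ j)) → Adj H₀ (support i) (support j)
  clique-adj i j c =
    from (Adj-H₀ (support i) (support j)) (inj₁ (clique⇒base {toℕ (support i)} {toℕ (support j)}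
    (subst₂ (λ x y → T (clique x y)) (sym (toℕ-support i)) (sym (toℕ-support j)) c)))

  link-adj : ∀ i j → T (link (toℕ i) (toℕ j)) → Adj G (support i) (support j)
  link-adj i j l =
    from (Adj-G (support i) (support j)) (inj₁ (link⇒edge {toℕ (support i)} {toℕ (support j)}
    (subst₂ (λ x y → T (link x y)) (sym (toℕ-support i)) (sym (toℕ-support j)) l)))

  leaf-sole : ∀ i x → Adj G (leaf i) x → x ≡ support i
  leaf-sole i x a with to (Adj-G (leaf i) x) a
  ... | inj₁ e = ⊥-elim (<⇒≱ (edge⇒support e) (m≤leaf i))
  ... | inj₂ e = toℕ-injective (begin
      toℕ x            ≡⟨ +-cancelˡ-≡ m (toℕ x) (toℕ i)
                            (trans (sym (edge-into-leaf e (m≤leaf i))) (toℕ-leaf i)) ⟩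
      toℕ i            ≡⟨ sym (toℕ-support i) ⟩
      toℕ (support i)  ∎)
    where open ≡-Reasoning

  private-sole : ∀ i → toℕ i < k → ∀ x → Adj H₀ (support i) x → x ≡ leaf i
  private-sole i i<k x a = toℕ-injective (begin
      toℕ x                ≡⟨ base-at-private (subst (_< k) (sym (toℕ-support i)) i<k)
                                              (to (Adj-H₀ (support i) x) a) ⟩
      m + toℕ (support i)  ≡⟨ cong (m +_) (toℕ-support i) ⟩
      m + toℕ i            ≡⟨ sym (toℕ-leaf i) ⟩
      toℕ (leaf i)         ∎)
    where open ≡-Reasoning

  clique-neighbour : ∀ i → k ≤ toℕ i → ∃[ j ] Adj H₀ (support i) (support j)
  clique-neighbour i k≤i with toℕ i ≟ k
  ... | yes i≡k =
    j , clique-adj i j (clique⁺ k≤i (subst₂ _<_ (sym i≡k) (sym (toℕ-fromℕ< k+1<m)) ≤-refl) (toℕ<n j))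
    where
    k+1<m : suc k < m
    k+1<m = s≤s (subst (_≤ k + b) (+-comm k 1) (+-monoʳ-≤ k 1≤b))
    j = fromℕ< k+1<m
  ... | no  i≢k = j , Adj-sym H₀ (support j) (support i)
                        (clique-adj j i (clique⁺ (≤-reflexive k≡j) (subst (_< toℕ i) k≡j k<i) (toℕ<n i)))
    where
    j = fromℕ< k<m
    k≡j : k ≡ toℕ j
    k≡j = sym (toℕ-fromℕ< k<m)
    k<i : k < toℕ i
    k<i = ≤∧≢⇒< k≤i (i≢k ∘ sym)

  link-neighbour : ∀ i → toℕ i < k → ∃[ j ] Adj G (support i) (support j)
  link-neighbour i i<k with toℕ i <? b
  ... | yes i<b = j , link-adj i j (subst₂ (λ x y → T (link x y)) partner≡i (sym (toℕ-fromℕ< i+s<m))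
                                      (link⁺ (m≤n+m s (toℕ i)) (+-monoˡ-< s i<b)))
    where
    i+s<m : toℕ i + s < m
    i+s<m = <-trans (+-monoˡ-< s i<b) b+s<m
    j = fromℕ< i+s<m
    partner≡i : partner (toℕ i + s) ≡ toℕ i
    partner≡i = trans (cong (_⊓ pred k) (m+n∸n≡m (toℕ i) s)) (m≤n⇒m⊓n≡m (<⇒≤pred i<k))
  ... | no  i≮b = j , Adj-sym G (support j) (support i)
                        (link-adj j i (subst (λ x → T (link x (toℕ i))) (sym (toℕ-fromℕ< partner<m))
                                        (link⁺ (≤-trans (m⊓n≤n k b) (≮⇒≥ i≮b)) (<-≤-trans i<k k≤b+s))))
    where
    partner<m : partner (toℕ i) < m
    partner<m = <-trans (partner<k (toℕ i)) k<m
    j = fromℕ< partner<m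

  H₀-no-isolated : NoIsolated H₀
  H₀-no-isolated v with vertex v
  ... | at-support i = leaf i , support-leaf i
  ... | at-leaf i    = support i , leaf-support i

  support∈below : ∀ {a} i → m ≤ a → support i ∈ below a
  support∈below i m≤a = ∈below (<-≤-trans (support<m i) m≤a)

  leaf<m+k : ∀ {i} → toℕ i < k → toℕ (leaf i) < m + k
  leaf<m+k {i} i<k = subst (_< m + k) (sym (toℕ-leaf i)) (+-monoʳ-< m i<k)

  m+k≤n : m + k ≤ n
  m+k≤n = +-monoʳ-≤ m (<⇒≤ k<m)

  supports supports⁺ : Subset n
  supports  = below m
  supports⁺ = below (m + k)

  supports-dominate : IsTDS G supports
  supports-dominate v with vertex v
  ... | at-leaf i = support i , support∈below i ≤-refl , H₀⊆G (leaf i) (support i) (leaf-support i)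
  ... | at-support i with toℕ i <? k
  ...   | yes i<k = let (j , ij∈G) = link-neighbour i i<k in support j , support∈below j ≤-refl , ij∈G
  ...   | no  i≮k = let (j , ij∈H₀) = clique-neighbour i (≮⇒≥ i≮k) in
                    support j , support∈below j ≤-refl , H₀⊆G (support i) (support j) ij∈H₀

  supports-forced : ∀ H S → SpanningSub H G → IsTDS H S → supports ⊆ S
  supports-forced H S H⊆G S-dominates {x} x∈below with vertex x
  ... | at-support i = sole-neighbour-∈ G H S (leaf i) H⊆G (leaf-sole i) S-dominates
  ... | at-leaf i    = ⊥-elim (<⇒≱ (∈below⁻ x∈below) (m≤leaf i))

  γt-G : IsGammaT G m
  γt-G = subst (IsGammaT G) (∣below∣ n m m≤n)
           (⊆-every-TDS⇒IsGammaT G supports supports-dominate (λ S → supports-forced G S (λ _ _ → id)))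

  supports⁺-dominate : IsTDS H₀ supports⁺
  supports⁺-dominate v with vertex v
  ... | at-leaf i = support i , support∈below i (m≤m+n m k) , leaf-support i
  ... | at-support i with toℕ i <? k
  ...   | yes i<k = leaf i , ∈below (leaf<m+k i<k) , support-leaf i
  ...   | no  i≮k = let (j , ij∈H₀) = clique-neighbour i (≮⇒≥ i≮k) in
                    support j , support∈below j (m≤m+n m k) , ij∈H₀

  supports⁺-forced : ∀ S → IsTDS H₀ S → supports⁺ ⊆ S
  supports⁺-forced S S-dominates {x} x∈below with vertex x
  ... | at-support i = supports-forced H₀ S H₀⊆G S-dominates (support∈below i ≤-refl)
  ... | at-leaf i    = sole-neighbour-∈ H₀ H₀ S (support i) (λ _ _ → id) (private-sole i i<k) S-dominates
    where
    i<k : toℕ i < k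
    i<k = +-cancelˡ-< m (toℕ i) k (subst (_< m + k) (toℕ-leaf i) (∈below⁻ x∈below))

  γt-H₀ : IsGammaT H₀ (m + k)
  γt-H₀ = subst (IsGammaT H₀) (∣below∣ n (m + k) m+k≤n)
            (⊆-every-TDS⇒IsGammaT H₀ supports⁺ supports⁺-dominate supports⁺-forced)

  link-count : ∑[ u < n ] ∑[ v < n ] 𝟙 (link (toℕ u) (toℕ v)) ≡ b
  link-count = begin
      ∑[ u < n ] ∑[ v < n ] 𝟙 (link (toℕ u) (toℕ v))
    ≡⟨ ∑-comm {n} {n} (λ u v → 𝟙 (link (toℕ u) (toℕ v))) ⟩
      ∑[ v < n ] ∑[ u < n ] 𝟙 (link (toℕ u) (toℕ v))
    ≡⟨ sum-cong-≗ {n} (λ v → count-≡ n (partner (toℕ v)) ((s ≤ᵇ toℕ v) ∧ (toℕ v <ᵇ b + s))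
                               (<-≤-trans (<-trans (partner<k (toℕ v)) k<m) m≤n)) ⟩
      ∑[ v < n ] 𝟙 ((s ≤ᵇ toℕ v) ∧ (toℕ v <ᵇ b + s))
    ≡⟨ count-between n s (b + s) (m≤n+m s b) (<⇒≤ (<-≤-trans b+s<m m≤n)) ⟩
      b + s ∸ s
    ≡⟨ m+n∸n≡m b s ⟩
      b
    ∎
    where open ≡-Reasoning

  outgoing incoming star : ℕ → ℕ → ℕ → Bool
  outgoing p i j = (i ≡ᵇ p) ∧ ((p <ᵇ j) ∧ (j <ᵇ m))
  incoming p i j = (j ≡ᵇ p) ∧ ((k ≤ᵇ i) ∧ (i <ᵇ p))
  star     p i j = outgoing p i j ∨ incoming p i j

  outgoing⁻ : ∀ {p i j} → T (outgoing p i j) → i ≡ p × p < j × j < m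
  outgoing⁻ {p} {i} {j} t with to T-∧ t
  ... | i≡p , t′ with to (T-∧ {p <ᵇ j}) t′
  ...   | p<j , j<m = ≡ᵇ⇒≡ i p i≡p , <ᵇ⇒< p j p<j , <ᵇ⇒< j m j<m

  incoming⁻ : ∀ {p i j} → T (incoming p i j) → j ≡ p × k ≤ i × i < p
  incoming⁻ {p} {i} {j} t with to (T-∧ {j ≡ᵇ p}) t
  ... | j≡p , t′ with to (T-∧ {k ≤ᵇ i}) t′
  ...   | k≤i , i<p = ≡ᵇ⇒≡ j p j≡p , ≤ᵇ⇒≤ k i k≤i , <ᵇ⇒< i p i<p

  star-count : ∀ p → k ≤ p → p < m → ∑[ u < n ] ∑[ v < n ] 𝟙 (star p (toℕ u) (toℕ v)) ≡ b
  star-count p k≤p p<m = begin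
      ∑[ u < n ] ∑[ v < n ] 𝟙 (star p (toℕ u) (toℕ v))
    ≡⟨ sum-cong-≗ {n} (λ u → sum-cong-≗ {n} (λ v → 𝟙-∨ (out u v) (inc u v) (disjoint u v))) ⟩
      ∑[ u < n ] ∑[ v < n ] (𝟙 (out u v) + 𝟙 (inc u v))
    ≡⟨ sum-cong-≗ {n} (λ u → ∑-distrib-+ (λ v → 𝟙 (out u v)) (λ v → 𝟙 (inc u v))) ⟩
      ∑[ u < n ] (∑[ v < n ] 𝟙 (out u v) + ∑[ v < n ] 𝟙 (inc u v))
    ≡⟨ ∑-distrib-+ (λ u → ∑[ v < n ] 𝟙 (out u v)) (λ u → ∑[ v < n ] 𝟙 (inc u v)) ⟩
      ∑[ u < n ] ∑[ v < n ] 𝟙 (out u v) + ∑[ u < n ] ∑[ v < n ] 𝟙 (inc u v)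
    ≡⟨ cong₂ _+_ out-count inc-count ⟩
      (m ∸ suc p) + (p ∸ k)
    ≡⟨ ∸-telescope k≤p (≤-pred p<m) ⟩
      b
    ∎
    where
    open ≡-Reasoning
    p<n = <-≤-trans p<m m≤n
    out inc : Fin n → Fin n → Bool
    out u v = outgoing p (toℕ u) (toℕ v)
    inc u v = incoming p (toℕ u) (toℕ v)
    disjoint : ∀ u v → ¬ (T (out u v) × T (inc u v))
    disjoint u v (o , i) =
      <-irrefl (proj₁ (outgoing⁻ {p} {toℕ u} {toℕ v} o)) (proj₂ (proj₂ (incoming⁻ {p} {toℕ u} {toℕ v} i)))
    out-count : ∑[ u < n ] ∑[ v < n ] 𝟙 (out u v) ≡ m ∸ suc p
    out-count = trans (∑-comm {n} {n} (λ u v → 𝟙 (out u v)))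
                  (trans (sum-cong-≗ {n} (λ v → count-≡ n p ((p <ᵇ toℕ v) ∧ (toℕ v <ᵇ m)) p<n))
                    (count-between n (suc p) m p<m m≤n))
    inc-count : ∑[ u < n ] ∑[ v < n ] 𝟙 (inc u v) ≡ p ∸ k
    inc-count = trans (sum-cong-≗ {n} (λ u → count-≡ n p ((k ≤ᵇ toℕ u) ∧ (toℕ u <ᵇ p)) p<n))
                  (count-between n k p k≤p (<⇒≤ p<n))

  SupportNeighbour : Graph n → Fin n → Set
  SupportNeighbour H v = ∃[ u ] toℕ u < m × Adj H v u

  supportNeighbour? : ∀ H v → Dec (SupportNeighbour H v)
  supportNeighbour? H v = any? (λ u → (toℕ u <? m) ×-dec T? (adj H v u))

  links-removed : ∀ H → SpanningSub H G → (∀ v → toℕ v < k → ¬ SupportNeighbour H v) →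
                  b ≤ edgeCount G ∸ edgeCount H
  links-removed H H⊆G lonely = subst (_≤ edgeCount G ∸ edgeCount H) link-count
    (removedCount-≥ G H H⊆G (λ u v → link (toℕ u) (toℕ v)) link⇒Removed)
    where
    link⇒Removed : ∀ u v → T (link (toℕ u) (toℕ v)) → Removed G H u v
    link⇒Removed u v l = let (u<k , u<v , v<m) = link⁻ {toℕ u} {toℕ v} l in
      u<v , from (Adj-G u v) (inj₁ (link⇒edge {toℕ u} {toℕ v} l)) ,
      λ uv∈H → lonely u u<k (v , v<m , uv∈H)

  star-removed : ∀ H → SpanningSub H G → ∀ p → k ≤ toℕ p → toℕ p < m → ¬ SupportNeighbour H p →
                 b ≤ edgeCount G ∸ edgeCount H
  star-removed H H⊆G p k≤p p<m lonely = subst (_≤ edgeCount G ∸ edgeCount H) (star-count (toℕ p) k≤p p<m)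
    (removedCount-≥ G H H⊆G (λ u v → star (toℕ p) (toℕ u) (toℕ v)) star⇒Removed)
    where
    clique-edge : ∀ u v → T (clique (toℕ u) (toℕ v)) → Adj G u v
    clique-edge u v c =
      from (Adj-G u v) (inj₁ (base⇒edge {toℕ u} {toℕ v} (clique⇒base {toℕ u} {toℕ v} c)))
    star⇒Removed : ∀ u v → T (star (toℕ p) (toℕ u) (toℕ v)) → Removed G H u v
    star⇒Removed u v t with to (T-∨ {outgoing (toℕ p) (toℕ u) (toℕ v)}) t
    ... | inj₁ o with outgoing⁻ {toℕ p} {toℕ u} {toℕ v} o
    ...   | u≡p , p<v , v<m with toℕ-injective {i = u} {p} u≡p
    ...     | refl = p<v , clique-edge p v (clique⁺ k≤p p<v v<m) , λ pv∈H → lonely (v , v<m , pv∈H)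
    star⇒Removed u v t | inj₂ i with incoming⁻ {toℕ p} {toℕ u} i
    ...   | v≡p , k≤u , u<p with toℕ-injective {i = v} {p} v≡p
    ...     | refl = u<p , clique-edge u p (clique⁺ k≤u u<p p<m) ,
                     λ up∈H → lonely (u , <-trans u<p p<m , Adj-sym H u p up∈H)

  smaller-TDS : ∀ H → SpanningSub H G → NoIsolated H →
                ∀ c → toℕ c < k → SupportNeighbour H (support c) →
                (∀ v → k ≤ toℕ v → toℕ v < m → SupportNeighbour H v) →
                ∃[ D ] IsTDS H D × ∣ D ∣ < m + k
  smaller-TDS H H⊆G no-isolated c c<k c-linked cliques-linked = D , D-dominates , ∣D∣<m+k
    where
    D = supports⁺ - leaf c
    ∈D : ∀ {x} → toℕ x < m + k → x ≢ leaf c → x ∈ D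
    ∈D x<m+k x≢ = x∈p∧x≢y⇒x∈p-y (∈below x<m+k) x≢
    support∈D : ∀ {x} → toℕ x < m → x ∈ D
    support∈D {x} x<m = ∈D (<-≤-trans x<m (m≤m+n m k)) λ { refl → <⇒≱ x<m (m≤leaf c) }
    leaf-kept : ∀ i → Adj H (leaf i) (support i)
    leaf-kept i = sole-neighbour-kept G H (leaf i) H⊆G (leaf-sole i) no-isolated
    D-dominates : IsTDS H D
    D-dominates v with vertex v
    ... | at-leaf i = support i , support∈D (support<m i) , leaf-kept i
    ... | at-support i with toℕ i <? k | i Fin.≟ c
    ...   | no  i≮k | _ =
      let (u , u<m , iu∈H) = cliques-linked (support i) (subst (k ≤_) (sym (toℕ-support i)) (≮⇒≥ i≮k))
                                            (support<m i)
      in u , support∈D u<m , iu∈H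
    ...   | yes _   | yes refl = let (u , u<m , cu∈H) = c-linked in u , support∈D u<m , cu∈H
    ...   | yes i<k | no  i≢c  =
      leaf i , ∈D (leaf<m+k i<k) (i≢c ∘ ↑ʳ-injective m i c) , Adj-sym H (leaf i) (support i) (leaf-kept i)
    ∣D∣<m+k : ∣ D ∣ < m + k
    ∣D∣<m+k = subst (∣ D ∣ <_) (∣below∣ n (m + k) m+k≤n) (x∈p⇒∣p-x∣<∣p∣ (∈below (leaf<m+k c<k)))

  below-m⇒support : ∀ v → toℕ v < m → ∃[ i ] v ≡ support i
  below-m⇒support v v<m with vertex v
  ... | at-support i = i , refl
  ... | at-leaf i    = ⊥-elim (<⇒≱ v<m (m≤leaf i))

  b≤removed : ∀ H → SpanningSub H G → NoIsolated H → (∀ D → IsTDS H D → m + k ≤ ∣ D ∣) →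
                b ≤ edgeCount G ∸ edgeCount H
  b≤removed H H⊆G no-isolated γt-H≥m+k
    with any? (λ v → (toℕ v <? k) ×-dec supportNeighbour? H v)
  ... | no  none = links-removed H H⊆G (λ v v<k linked → none (v , v<k , linked))
  ... | yes (c , c<k , c-linked)
    with any? (λ v → ((k ≤? toℕ v) ×-dec (toℕ v <? m)) ×-dec ¬? (supportNeighbour? H v))
  ...   | yes (p , (k≤p , p<m) , lonely) = star-removed H H⊆G p k≤p p<m lonely
  ...   | no  no-lonely with below-m⇒support c (<-trans c<k k<m)
  ...     | i , refl =
    let (D , D-dominates , ∣D∣<m+k) = smaller-TDS H H⊆G no-isolated i i<k c-linked cliques-linked
    in ⊥-elim (<⇒≱ ∣D∣<m+k (γt-H≥m+k D D-dominates))
    where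
    i<k : toℕ i < k
    i<k = subst (_< k) (toℕ-support i) c<k
    cliques-linked : ∀ v → k ≤ toℕ v → toℕ v < m → SupportNeighbour H v
    cliques-linked v k≤v v<m with supportNeighbour? H v
    ... | yes linked = linked
    ... | no  lonely = ⊥-elim (no-lonely (v , (k≤v , v<m) , lonely))

  bondage-lower : ∀ H d → KDeletion k G H d → b ≤ d
  bondage-lower H d
    (H⊆G , no-isolated , d≡ , g , g′ , ((S , S-dominates , ∣S∣≡g) , _) , (_ , γt-H-min) , g+k≤g′) =
    subst (b ≤_) d≡ (b≤removed H H⊆G no-isolated λ D D-dominates →
      ≤-trans (+-monoˡ-≤ k m≤g) (≤-trans g+k≤g′ (γt-H-min D D-dominates)))
    where
    m≤g : m ≤ g
    m≤g = subst₂ _≤_ (∣below∣ n m m≤n) ∣S∣≡g (p⊆q⇒∣p∣≤∣q∣ (supports-forced G S (λ _ _ → id) S-dominates))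

  edgeCount-G∸H₀ : edgeCount G ∸ edgeCount H₀ ≡ b
  edgeCount-G∸H₀ =
    trans (sym (removedCount-≡ G H₀ H₀⊆G (λ u v → link (toℕ u) (toℕ v)) link⇒Removed Removed⇒link)) link-count
    where
    link⇒Removed : ∀ u v → T (link (toℕ u) (toℕ v)) → Removed G H₀ u v
    link⇒Removed u v l = let (u<k , u<v , v<m) = link⁻ {toℕ u} {toℕ v} l in
      u<v , from (Adj-G u v) (inj₁ (link⇒edge {toℕ u} {toℕ v} l)) , λ uv∈H₀ →
      <⇒≱ v<m (subst (m ≤_) (sym (base-at-private u<k (to (Adj-H₀ u v) uv∈H₀))) (m≤m+n m (toℕ u)))
    Removed⇒link : ∀ u v → Removed G H₀ u v → T (link (toℕ u) (toℕ v))
    Removed⇒link u v (u<v , uv∈G , uv∉H₀) with to (Adj-G u v) uv∈G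
    ... | inj₂ e = ⊥-elim (<-asym u<v (edge⇒< {toℕ v} {toℕ u} e))
    ... | inj₁ e with to (T-∨ {base (toℕ u) (toℕ v)}) e
    ...   | inj₁ b = ⊥-elim (uv∉H₀ (from (Adj-H₀ u v) (inj₁ b)))
    ...   | inj₂ l = l

  bondage : IsKTotalBondage k G b
  bondage =
    (H₀ , H₀⊆G , H₀-no-isolated , edgeCount-G∸H₀ , m , m + k , γt-G , γt-H₀ , ≤-refl) , bondage-lower

  G-no-isolated : NoIsolated G
  G-no-isolated = NoIsolated-mono G H₀ H₀⊆G H₀-no-isolated

theorem4p1 : ∀ (k b : ℕ) → 1 ≤ k → 1 ≤ b → k ≤ 2 * b →
    ∃[ n ] Σ (Graph n) (λ G → NoIsolated G × IsKTotalBondage k G b)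
theorem4p1 k b 1≤k 1≤b k≤2b = n , G , G-no-isolated , bondage
  where open Construction k b 1≤k 1≤b k≤2b
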